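{- Let $q$ be a sufficiently large positive integer and $B\subset[1,q]\cap\mathbb{Z}$ with $\operatorname{card}(B)\ge\frac78q$. Then every integer in the interval $[q+1,\frac{13}{8}q]$ belongs to $2^{\wedge}B$.
   Context: $2^{\wedge}B=\{b+b':b,b'\in B,\ b\ne b'\}$ denotes the set of sums of two distinct elements of $B$. -}

module Defs where

open import Data.Nat using (ℕ; _+_; _≤_)
open import Data.Product using (∃-syntax; _×_)
open import Data.List using (List)
open import Data.List.Membership.Propositional using (_∈_)
open import Data.List.Relation.Unary.All using (All)
open import Relation.Binary.PropositionalEquality using (_≡_; _≢_)

InRange : ℕ → List ℕ → Set
InRange q B = All (λ b → 1 ≤ b × b ≤ q) B

_∈2^_ : ℕ → List ℕ → Set
n ∈2^ B = ∃[ b ] ∃[ b′ ] (b ∈ B × b′ ∈ B × b ≢ b′ × b + b′ ≡ n)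

module Submission where

-- Fix n with q < n and let B ⊆ [1,q] be a list of distinct
-- numbers containing no two distinct elements summing to n.  Every b ∈ B
-- satisfies b ≤ n, so its "reflection" r_n(b) = min(b, n − b) lies in
-- [0, ⌊n/2⌋].  Two distinct elements with the same reflection must be
-- partners, b + b′ = n; hence r_n is injective on B, and by the
-- pigeonhole principle |B| ≤ ⌊n/2⌋ + 1.  With |B| ≥ 7q/8 and n ≤ 13q/8
-- this gives 7q ≤ 8(n/2 + 1) ≤ 13q/2 + 8, i.e. q ≤ 16.  So for q ≥ 17
-- every such n lies in 2^B, and we may take q₀ = 17.

open import Defs
open import Data.Nat using (ℕ; suc; _+_; _*_; _∸_; _⊓_; _≤_; _<_; _<?_; _≟_; z≤n; s≤s; s≤s⁻¹; ⌊_/2⌋)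
open import Data.Nat.Properties
open import Data.Nat.Tactic.RingSolver using (solve-∀)
open import Data.Product using (∃-syntax; _×_; _,_)
open import Data.Sum using (_⊎_; inj₁; inj₂; fromInj₁)
open import Data.List using (List; []; _∷_; length; map; filter)
open import Data.List.Properties using (filter-accept; filter-reject; filter-all; length-map)
open import Data.List.Relation.Unary.All as All using (All; _∷_)
open import Data.List.Relation.Unary.All.Properties using (all-filter; ¬Any⇒All¬; map⁺)
open import Data.List.Relation.Unary.Any using (here; there; any?)
open import Data.List.Relation.Unary.AllPairs using ([]; _∷_)
open import Data.List.Relation.Unary.Unique.Propositional using (Unique)
import Data.List.Relation.Unary.Unique.Propositional.Properties as Unique
open import Data.List.Membership.Propositional using (_∈_)
open import Data.List.Membership.Propositional.Properties using (∈-map⁻)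
open import Relation.Binary.PropositionalEquality using (_≡_; _≢_; refl; sym; trans; cong; subst)
open import Relation.Nullary using (yes; no; contradiction)

-- Pigeonhole, one step: among distinct numbers below k + 1, at most one
-- (namely k itself) fails to be below k.
at-most-one-top : ∀ k (xs : List ℕ) → Unique xs → All (_< suc k) xs →
                  length xs ≤ suc (length (filter (_<? k) xs))
at-most-one-top k [] _ _ = z≤n
at-most-one-top k (x ∷ xs) (x∉xs ∷ uxs) (x≤k ∷ xs≤k) with x <? k
... | yes x<k rewrite filter-accept (_<? k) {xs = xs} x<k =
  s≤s (at-most-one-top k xs uxs xs≤k)
... | no x≮k = s≤s (≤-reflexive (sym (cong length filter-drops-only-x)))
  where
  x≡k : x ≡ k
  x≡k = ≤-antisym (s≤s⁻¹ x≤k) (≮⇒≥ x≮k)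
  rest<k : All (_< k) xs
  rest<k = All.zipWith (λ (y≤k , x≢y) → ≤∧≢⇒< (s≤s⁻¹ y≤k) (λ y≡k → x≢y (trans x≡k (sym y≡k))))
                       (xs≤k , x∉xs)
  filter-drops-only-x : filter (_<? k) (x ∷ xs) ≡ xs
  filter-drops-only-x = trans (filter-reject (_<? k) x≮k) (filter-all (_<? k) rest<k)

unique-bounded-length : ∀ k (xs : List ℕ) → Unique xs → All (_< k) xs → length xs ≤ k
unique-bounded-length 0 [] _ _ = z≤n
unique-bounded-length 0 (x ∷ xs) _ (() ∷ _)
unique-bounded-length (suc k) xs uxs xs<k =
  ≤-trans (at-most-one-top k xs uxs xs<k)
          (s≤s (unique-bounded-length k _ (Unique.filter⁺ (_<? k) uxs) (all-filter (_<? k) xs)))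

Collision : {A : Set} → (A → ℕ) → List A → Set
Collision f xs = ∃[ x ] ∃[ y ] (x ∈ xs × y ∈ xs × x ≢ y × f x ≡ f y)

collision-or-unique : {A : Set} (f : A → ℕ) (xs : List A) → Unique xs →
                      Collision f xs ⊎ Unique (map f xs)
collision-or-unique f [] _ = inj₂ []
collision-or-unique f (x ∷ xs) (x∉xs ∷ uxs) with collision-or-unique f xs uxs
... | inj₁ (y , z , y∈ , z∈ , y≢z , fy≡fz) = inj₁ (y , z , there y∈ , there z∈ , y≢z , fy≡fz)
... | inj₂ uniq with any? (f x ≟_) (map f xs)
...   | no fx∉ = inj₂ (¬Any⇒All¬ _ fx∉ ∷ uniq)
...   | yes fx∈ with ∈-map⁻ f fx∈
...     | y , y∈ , fx≡fy = inj₁ (x , y , here refl , there y∈ , All.lookup x∉xs y∈ , fx≡fy)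

reflect : ℕ → ℕ → ℕ
reflect n b = b ⊓ (n ∸ b)

reflect-≤-half : ∀ n b → b ≤ n → reflect n b ≤ ⌊ n /2⌋
reflect-≤-half n b b≤n = subst (_≤ ⌊ n /2⌋) (sym (n≡⌊n+n/2⌋ (reflect n b))) (⌊n/2⌋-mono double≤n)
  where
  double≤n : reflect n b + reflect n b ≤ n
  double≤n = ≤-trans (+-mono-≤ (m⊓n≤m b (n ∸ b)) (m⊓n≤n b (n ∸ b))) (≤-reflexive (m+[n∸m]≡n b≤n))

reflect-collision : ∀ n x y → x ≤ n → y ≤ n → x ≢ y → reflect n x ≡ reflect n y → x + y ≡ n
reflect-collision n x y x≤n y≤n x≢y eq with ⊓-sel x (n ∸ x) | ⊓-sel y (n ∸ y)
... | inj₁ rx | inj₁ ry = contradiction (trans (sym rx) (trans eq ry)) x≢y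
... | inj₁ rx | inj₂ ry = trans (cong (_+ y) (trans (sym rx) (trans eq ry))) (m∸n+n≡m y≤n)
... | inj₂ rx | inj₁ ry = trans (cong (x +_) (trans (sym ry) (trans (sym eq) rx))) (m+[n∸m]≡n x≤n)
... | inj₂ rx | inj₂ ry = contradiction (∸-cancelˡ-≡ x≤n y≤n (trans (sym rx) (trans eq ry))) x≢y

in-2^-or-small : ∀ n (B : List ℕ) → Unique B → All (_≤ n) B →
                 n ∈2^ B ⊎ length B ≤ suc ⌊ n /2⌋
in-2^-or-small n B uB B≤n with collision-or-unique (reflect n) B uB
... | inj₁ (x , y , x∈ , y∈ , x≢y , eq) =
  inj₁ (x , y , x∈ , y∈ , x≢y , reflect-collision n x y (All.lookup B≤n x∈) (All.lookup B≤n y∈) x≢y eq)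
... | inj₂ uniq = inj₂ (subst (_≤ suc ⌊ n /2⌋) (length-map (reflect n) B)
                              (unique-bounded-length (suc ⌊ n /2⌋) _ uniq reflections<))
  where
  reflections< : All (_< suc ⌊ n /2⌋) (map (reflect n) B)
  reflections< = map⁺ (All.map (λ {b} b≤n → s≤s (reflect-≤-half n b b≤n)) B≤n)

small-forces-q≤16 : ∀ q L n → 7 * q ≤ 8 * L → L ≤ suc ⌊ n /2⌋ → 8 * n ≤ 13 * q → q ≤ 16
small-forces-q≤16 q L n 7q≤8L L≤ 8n≤13q = +-cancelˡ-≤ (13 * q) q 16 (begin
    13 * q + q             ≡⟨ twice-7q q ⟩
    2 * (7 * q)            ≤⟨ *-monoʳ-≤ 2 7q≤8L ⟩
    2 * (8 * L)            ≡⟨ *-assoc 2 8 L ⟨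
    16 * L                 ≤⟨ *-monoʳ-≤ 16 L≤ ⟩
    16 * suc K             ≡⟨ sixteen-suc K ⟩
    16 + 8 * (K + K)       ≤⟨ +-monoʳ-≤ 16 (*-monoʳ-≤ 8 halves≤n) ⟩
    16 + 8 * n             ≤⟨ +-monoʳ-≤ 16 8n≤13q ⟩
    16 + 13 * q            ≡⟨ +-comm 16 (13 * q) ⟩
    13 * q + 16            ∎)
  where
  open ≤-Reasoning
  K = ⌊ n /2⌋
  twice-7q : ∀ q → 13 * q + q ≡ 2 * (7 * q)
  twice-7q = solve-∀
  sixteen-suc : ∀ K → 16 * suc K ≡ 16 + 8 * (K + K)
  sixteen-suc = solve-∀
  halves≤n : K + K ≤ n
  halves≤n = ≤-trans (+-monoʳ-≤ K (⌊n/2⌋≤⌈n/2⌉ n)) (≤-reflexive (⌊n/2⌋+⌈n/2⌉≡n n))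

lemma16 : ∃[ q₀ ] ∀ (q : ℕ) → q₀ ≤ q → (B : List ℕ) → Unique B → InRange q B →
    7 * q ≤ 8 * length B →
    ∀ (n : ℕ) → q + 1 ≤ n → 8 * n ≤ 13 * q → n ∈2^ B
lemma16 = 17 , λ q 17≤q B uB B⊆[1,q] dense n q<n 8n≤13q →
  let B≤n = All.map (λ (_ , b≤q) → ≤-trans b≤q (≤-trans (m≤m+n q 1) q<n)) B⊆[1,q]
      too-dense = λ small → contradiction (small-forces-q≤16 q (length B) n dense small 8n≤13q)
                                          (<⇒≱ 17≤q)
  in fromInj₁ too-dense (in-2^-or-small n B uB B≤n)
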